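{- Let $M=(E,\rho)$ be a matroid of rank $d\ge1$ and let $e\in E$. Then for all $0\le i\le d-1$ and all $S\in\mathcal{S}_i^M$ with $e\in S$: (a) if $e$ is a loop then $\mu_i^M(S)=0$; (b) if $e$ is a coloop then $\mu_i^M(S)=-\mu_{i-1}^{M\setminus e}(S\setminus e)+\mu_i^{M/e}(S/e)$; (c) if $e$ is a link then $\mu_i^M(S)=-\mu_i^{M\setminus e}(S\setminus e)+\mu_i^{M/e}(S/e)$.
   Context: A matroid $N$ has finite ground set $E(N)$, rank function $\rho$ and rank $d(N)=\rho(E(N))$. A link is an element that is neither a loop nor a coloop. For an integer $i$, let $\mathcal{S}_i^N:=\{S\subseteq E(N):\rho(S)\ge d(N)-i\}$, ordered by inclusion, and $\mathcal{L}_i^N:=\{\hat0\}\oplus\mathcal{S}_i^N$ (a new minimum $\hat0$ adjoined); $\mu_i^N(S)$ denotes the Möbius function value $\mu(\hat0,S)$ in $\mathcal{L}_i^N$, and $\mu_i^N(S):=0$ if $S\notin\mathcal{S}_i^N$. (The paper defines these for $0\le i\le d(N)-1$; the same definition is applied to the minors $M\setminus e$, $M/e$ for the indices appearing above.) For $e\in S$, $S\setminus e$ is regarded as a subset of $E(M\setminus e)$ and $S/e$ denotes $S\setminus e$ regarded as a subset of $E(M/e)$. -}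

module Defs where

open import Data.Nat as ℕ using (ℕ; zero; suc)
open import Data.Integer as ℤ using (ℤ; +_; -_; _-_)
open import Data.Bool using (true; false)
open import Data.Fin using (Fin)
open import Data.Fin.Subset using (Subset; _⊆_; _∪_; _∩_; ∣_∣; ⁅_⁆; ⊤)
  renaming (_-_ to _remove_)
open import Data.Fin.Subset.Properties using (_⊂?_)
open import Data.Vec using (Vec; []; _∷_; insertAt; removeAt)
open import Data.List using (List; []; _∷_; _++_; map; filter; foldr)
open import Relation.Nullary using (yes; no; ¬_)
open import Data.Product using (_×_)
open import Relation.Binary.PropositionalEquality using (_≡_)

record Matroid (n : ℕ) : Set where
  field
    ρ          : Subset n → ℕ
    ρ-bounded  : ∀ X → ρ X ℕ.≤ ∣ X ∣
    ρ-mono     : ∀ X Y → X ⊆ Y → ρ X ℕ.≤ ρ Y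
    ρ-submod   : ∀ X Y → ρ (X ∪ Y) ℕ.+ ρ (X ∩ Y) ℕ.≤ ρ X ℕ.+ ρ Y

open Matroid public

rank : ∀ {n} → (Subset n → ℕ) → ℕ
rank ρ = ρ ⊤

IsLoop : ∀ {n} → Matroid n → Fin n → Set
IsLoop M e = ρ M ⁅ e ⁆ ≡ 0

IsColoop : ∀ {n} → Matroid n → Fin n → Set
IsColoop M e = ρ M (⊤ remove e) ℕ.< ρ M ⊤

IsLink : ∀ {n} → Matroid n → Fin n → Set
IsLink M e = ¬ IsLoop M e × ¬ IsColoop M e

-- Minors.  E(M \ e) = E(M / e) = E(M) − e, identified with Fin n via
-- insertAt / removeAt at position e.

del : ∀ {n} → Matroid (suc n) → Fin (suc n) → Subset n → ℕ
del M e X = ρ M (insertAt X e false)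

con : ∀ {n} → Matroid (suc n) → Fin (suc n) → Subset n → ℕ
con M e X = ρ M (insertAt X e true) ℕ.∸ ρ M ⁅ e ⁆

-- S \ e  (equivalently S / e) as a subset of E(M) − e
_∖_ : ∀ {n} → Subset (suc n) → Fin (suc n) → Subset n
S ∖ e = removeAt S e

-- The Möbius function μ_i^N(S) = μ(0̂, S) in {0̂} ⊕ S_i^N, with
-- S_i^N = { S : ρ(S) ≥ d(N) − i }  (index i ∈ ℤ; μ_i^N(S) = 0 for S ∉ S_i^N).

allSubsets : (n : ℕ) → List (Subset n)
allSubsets zero    = [] ∷ []
allSubsets (suc n) = map (false ∷_) (allSubsets n) ++ map (true ∷_) (allSubsets n)

sumℤ : List ℤ → ℤ
sumℤ = foldr ℤ._+_ (+ 0)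

InS : ∀ {n} → (Subset n → ℕ) → ℤ → Subset n → Set
InS ρ i S = + rank ρ ℤ.≤ + ρ S ℤ.+ i

-- μ(0̂,S) = − Σ_{0̂ ≤ T < S} μ(0̂,T) = −1 − Σ_{T ∈ S_i, T ⊊ S} μ(0̂,T).
-- Recursion with fuel: at fuel suc k it is correct for |S| ≤ k.
μ-fuel : ∀ {n} → ℕ → (Subset n → ℕ) → ℤ → Subset n → ℤ
μ-fuel zero    ρ i S = + 0
μ-fuel {n} (suc k) ρ i S with + rank ρ ℤ.≤? + ρ S ℤ.+ i
... | no  _ = + 0
... | yes _ = - (+ 1 ℤ.+ sumℤ (map (μ-fuel k ρ i) (filter (_⊂? S) (allSubsets n))))

μ : ∀ {n} → (Subset n → ℕ) → ℤ → Subset n → ℤ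
μ {n} ρ i S = μ-fuel (suc n) ρ i S

-- Since 𝒮ᵢ is an up-set of the Boolean lattice, the recursion defining μ says
-- Σ_{T ⊆ S} μᵢ(T) = -[S ∈ 𝒮ᵢ] for every S, so by Möbius inversion
-- μᵢ(S) = -Σ_{T ⊆ S} (-1)^|S - T| [T ∈ 𝒮ᵢ].  Splitting this sum according to whether
-- e ∈ T writes μᵢᴹ(S) as minus the difference of the alternating sums over T ⊆ S - e of
-- [T + e ∈ 𝒮ᵢᴹ] and [T ∈ 𝒮ᵢᴹ].  Membership depends only on ρ(T) + i - d, so
-- [T + e ∈ 𝒮ᵢᴹ] = [T ∈ 𝒮ᵢ^{M/e}], while [T ∈ 𝒮ᵢᴹ] = [T ∈ 𝒮ᵢ^{M∖e}] for a link
-- (d(M∖e) = d) and [T ∈ 𝒮ᵢ₋₁^{M∖e}] for a coloop (d(M∖e) = d - 1).  For a loop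
-- ρ(T + e) = ρ(T), and the two alternating sums cancel.
{-# OPTIONS --safe #-}
module Submission where

open import Defs
open import Data.Nat using (ℕ; suc; _≤_)
open import Data.Integer using (ℤ; +_; -_; _+_; _-_)
open import Data.Fin using (Fin)
open import Data.Fin.Subset using (Subset; _∈_; ⊤)
open import Data.Product using (_×_)
open import Relation.Binary.PropositionalEquality using (_≡_)

open import Data.Nat as ℕ using (_∸_; _<_)
import Data.Nat.Properties as ℕₚ
import Data.Integer as ℤ
import Data.Integer.Properties as ℤₚ
open import Data.Integer.Tactic.RingSolver using (solve-∀)
open import Data.Bool using (true; false; if_then_else_)
open import Data.Fin using (zero; suc)
open import Data.Fin.Subset using (_⊆_; ⁅_⁆; _∪_; ∣_∣) renaming (_-_ to _remove_)
open import Data.Fin.Subset.Properties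
  using (_⊂?_; _⊆?_; ⊆-refl; s⊆s; out⊆; drop-∷-⊆; ⊆⊤; q⊆p∪q; p⊆p∪q; p⊂q⇒∣p∣<∣q∣; ∣p∣≤n;
         ∪-identityʳ; p─⊥≡p; ∣⁅x⁆∣≡1)
open import Data.Vec using ([]; _∷_; insertAt; removeAt; here; there)
open import Data.List using ([]; _∷_; _++_; map; filter)
import Data.List.Properties as Listₚ
open import Data.Bool.Properties using (∨-identityʳ)
open import Data.Product using (_,_)
open import Relation.Nullary using (yes; no; does; ¬_; contradiction)
open import Relation.Nullary.Decidable using (dec-true; dec-false)
open import Relation.Unary using (Decidable)
open import Relation.Binary using (_Preserves_⟶_)
open import Relation.Binary.PropositionalEquality
  using (_≗_; refl; sym; trans; cong; cong₂; subst; module ≡-Reasoning)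
open import Function using (_∘_)

sum⊆ altSum⊆ : ∀ {n} → Subset n → (Subset n → ℤ) → ℤ
sum⊆ []          f = f []
sum⊆ (false ∷ S) f = sum⊆ S (f ∘ (false ∷_))
sum⊆ (true  ∷ S) f = sum⊆ S (f ∘ (false ∷_)) + sum⊆ S (f ∘ (true ∷_))

altSum⊆ []          f = f []
altSum⊆ (false ∷ S) f = altSum⊆ S (f ∘ (false ∷_))
altSum⊆ (true  ∷ S) f = altSum⊆ S (f ∘ (true ∷_)) - altSum⊆ S (f ∘ (false ∷_))

altSum⊆-cong : ∀ {n} (S : Subset n) {f g : Subset n → ℤ} → f ≗ g → altSum⊆ S f ≡ altSum⊆ S g
altSum⊆-cong []          f≗g = f≗g []
altSum⊆-cong (false ∷ S) f≗g = altSum⊆-cong S (f≗g ∘ (false ∷_))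
altSum⊆-cong (true  ∷ S) f≗g =
  cong₂ _-_ (altSum⊆-cong S (f≗g ∘ (true ∷_))) (altSum⊆-cong S (f≗g ∘ (false ∷_)))

sum⊆-neg : ∀ {n} (S : Subset n) (f : Subset n → ℤ) → sum⊆ S (-_ ∘ f) ≡ - sum⊆ S f
sum⊆-neg []          f = refl
sum⊆-neg (false ∷ S) f = sum⊆-neg S (f ∘ (false ∷_))
sum⊆-neg (true  ∷ S) f =
  trans (cong₂ _+_ (sum⊆-neg S (f ∘ (false ∷_))) (sum⊆-neg S (f ∘ (true ∷_))))
        (sym (ℤₚ.neg-distrib-+ (sum⊆ S (f ∘ (false ∷_))) (sum⊆ S (f ∘ (true ∷_)))))

sum⊆-sub : ∀ {n} (S : Subset n) (f g : Subset n → ℤ) →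
  sum⊆ S (λ T → f T - g T) ≡ sum⊆ S f - sum⊆ S g
sum⊆-sub []          f g = refl
sum⊆-sub (false ∷ S) f g = sum⊆-sub S (f ∘ (false ∷_)) (g ∘ (false ∷_))
sum⊆-sub (true  ∷ S) f g =
  trans (cong₂ _+_ (sum⊆-sub S f₀ g₀) (sum⊆-sub S f₁ g₁))
        (interchange (sum⊆ S f₀) (sum⊆ S g₀) (sum⊆ S f₁) (sum⊆ S g₁))
  where
  f₀ f₁ g₀ g₁ : _ → ℤ
  f₀ = f ∘ (false ∷_)
  f₁ = f ∘ (true ∷_)
  g₀ = g ∘ (false ∷_)
  g₁ = g ∘ (true ∷_)
  interchange : ∀ a b c d → (a - b) + (c - d) ≡ (a + c) - (b + d)
  interchange = solve-∀

sum⊆-altSum⊆ : ∀ {n} (S : Subset n) (g : Subset n → ℤ) → sum⊆ S (λ T → altSum⊆ T g) ≡ g S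
sum⊆-altSum⊆ []          g = refl
sum⊆-altSum⊆ (false ∷ S) g = sum⊆-altSum⊆ S (g ∘ (false ∷_))
sum⊆-altSum⊆ (true  ∷ S) g = begin
  sum⊆ S (λ T → altSum⊆ T g₀) + sum⊆ S (λ T → altSum⊆ T g₁ - altSum⊆ T g₀)
    ≡⟨ cong₂ _+_ (sum⊆-altSum⊆ S g₀) (sum⊆-sub S (λ T → altSum⊆ T g₁) (λ T → altSum⊆ T g₀)) ⟩
  g₀ S + (sum⊆ S (λ T → altSum⊆ T g₁) - sum⊆ S (λ T → altSum⊆ T g₀))
    ≡⟨ cong (λ s → g₀ S + s) (cong₂ _-_ (sum⊆-altSum⊆ S g₁) (sum⊆-altSum⊆ S g₀)) ⟩
  g₀ S + (g₁ S - g₀ S)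
    ≡⟨ cancel (g₀ S) (g₁ S) ⟩
  g₁ S ∎
  where
  open ≡-Reasoning
  g₀ g₁ : _ → ℤ
  g₀ = g ∘ (false ∷_)
  g₁ = g ∘ (true ∷_)
  cancel : ∀ a b → a + (b - a) ≡ b
  cancel = solve-∀

altSum⊆-vanishes : ∀ {n} (S : Subset n) (f : Subset n → ℤ) →
  (∀ {T} → T ⊆ S → f T ≡ + 0) → altSum⊆ S f ≡ + 0
altSum⊆-vanishes []          f f≡0 = f≡0 ⊆-refl
altSum⊆-vanishes (false ∷ S) f f≡0 = altSum⊆-vanishes S _ (f≡0 ∘ out⊆)
altSum⊆-vanishes (true  ∷ S) f f≡0 =
  cong₂ _-_ (altSum⊆-vanishes S _ (f≡0 ∘ s⊆s)) (altSum⊆-vanishes S _ (f≡0 ∘ out⊆))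

altSum⊆-split : ∀ {n} (S : Subset (suc n)) (e : Fin (suc n)) (f : Subset (suc n) → ℤ) → e ∈ S →
  altSum⊆ S f ≡ altSum⊆ (S ∖ e) (λ T → f (insertAt T e true))
              - altSum⊆ (S ∖ e) (λ T → f (insertAt T e false))
altSum⊆-split (true ∷ S) zero f here = refl
altSum⊆-split {suc _} (false ∷ S@(_ ∷ _)) (suc e) f (there e∈S) = altSum⊆-split S e _ e∈S
altSum⊆-split {suc _} (true ∷ S@(_ ∷ _)) (suc e) f (there e∈S) =
  trans (cong₂ _-_ (altSum⊆-split S e _ e∈S) (altSum⊆-split S e _ e∈S))
        (interchange (alt (λ T → f (true ∷ insertAt T e true))) (alt (λ T → f (true ∷ insertAt T e false)))
                     (alt (λ T → f (false ∷ insertAt T e true))) (alt (λ T → f (false ∷ insertAt T e false))))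
  where
  alt = altSum⊆ (S ∖ e)
  interchange : ∀ a b c d → (a - b) - (c - d) ≡ (a - c) - (b - d)
  interchange = solve-∀

sumℤ-++ : ∀ xs ys → sumℤ (xs ++ ys) ≡ sumℤ xs + sumℤ ys
sumℤ-++ []       ys = sym (ℤₚ.+-identityˡ _)
sumℤ-++ (x ∷ xs) ys = trans (cong (λ s → x + s) (sumℤ-++ xs ys)) (sym (ℤₚ.+-assoc x _ _))

sumℤ-map-filter : ∀ {A : Set} {P : A → Set} (P? : Decidable P) (f : A → ℤ) xs →
  sumℤ (map f (filter P? xs)) ≡ sumℤ (map (λ x → if does (P? x) then f x else + 0) xs)
sumℤ-map-filter P? f []       = refl
sumℤ-map-filter P? f (x ∷ xs) with does (P? x)
... | true  = cong (λ s → f x + s) (sumℤ-map-filter P? f xs)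
... | false = trans (sumℤ-map-filter P? f xs) (sym (ℤₚ.+-identityˡ _))

sumAll : ∀ {n} → (Subset n → ℤ) → ℤ
sumAll {n} f = sumℤ (map f (allSubsets n))

sumAll-∷ : ∀ {n} (f : Subset (suc n) → ℤ) →
  sumAll f ≡ sumAll (f ∘ (false ∷_)) + sumAll (f ∘ (true ∷_))
sumAll-∷ {n} f = begin
  sumℤ (map f (map (false ∷_) A ++ map (true ∷_) A))
    ≡⟨ cong sumℤ (Listₚ.map-++ f (map (false ∷_) A) _) ⟩
  sumℤ (map f (map (false ∷_) A) ++ map f (map (true ∷_) A))
    ≡⟨ sumℤ-++ (map f (map (false ∷_) A)) _ ⟩
  sumℤ (map f (map (false ∷_) A)) + sumℤ (map f (map (true ∷_) A))
    ≡⟨ cong₂ _+_ (cong sumℤ (sym (Listₚ.map-∘ A))) (cong sumℤ (sym (Listₚ.map-∘ A))) ⟩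
  sumAll (f ∘ (false ∷_)) + sumAll (f ∘ (true ∷_)) ∎
  where
  open ≡-Reasoning
  A = allSubsets n

sumAll-cong : ∀ {n} {f g : Subset n → ℤ} → f ≗ g → sumAll f ≡ sumAll g
sumAll-cong {n} f≗g = cong sumℤ (Listₚ.map-cong f≗g (allSubsets n))

sumAll-0 : ∀ n → sumAll {n} (λ _ → + 0) ≡ + 0
sumAll-0 ℕ.zero = refl
sumAll-0 (suc n) = trans (sumAll-∷ {n} _) (cong₂ _+_ (sumAll-0 n) (sumAll-0 n))

sumAll-⊆ : ∀ {n} (S : Subset n) (g : Subset n → ℤ) →
  sumAll (λ T → if does (T ⊆? S) then g T else + 0) ≡ sum⊆ S g
sumAll-⊆ []          g = ℤₚ.+-identityʳ _
sumAll-⊆ {suc n} (false ∷ S) g = begin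
  sumAll (λ T → if does (T ⊆? false ∷ S) then g T else + 0)
    ≡⟨ sumAll-∷ (λ T → if does (T ⊆? false ∷ S) then g T else + 0) ⟩
  sumAll (λ T → if does (T ⊆? S) then g (false ∷ T) else + 0) + sumAll {n} (λ _ → + 0)
    ≡⟨ cong₂ _+_ (sumAll-⊆ S _) (sumAll-0 n) ⟩
  sum⊆ S (g ∘ (false ∷_)) + + 0
    ≡⟨ ℤₚ.+-identityʳ _ ⟩
  sum⊆ (false ∷ S) g ∎
  where open ≡-Reasoning
sumAll-⊆ (true  ∷ S) g =
  trans (sumAll-∷ (λ T → if does (T ⊆? true ∷ S) then g T else + 0))
        (cong₂ _+_ (sumAll-⊆ S _) (sumAll-⊆ S _))

sumAll-⊂ : ∀ {n} (S : Subset n) (g : Subset n → ℤ) →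
  sumAll (λ T → if does (T ⊂? S) then g T else + 0) ≡ sum⊆ S g - g S
sumAll-⊂ []          g = sym (ℤₚ.+-inverseʳ (g []))
sumAll-⊂ {suc n} (false ∷ S) g = begin
  sumAll (λ T → if does (T ⊂? false ∷ S) then g T else + 0)
    ≡⟨ sumAll-∷ (λ T → if does (T ⊂? false ∷ S) then g T else + 0) ⟩
  sumAll (λ T → if does (T ⊂? S) then g (false ∷ T) else + 0) + sumAll {n} (λ _ → + 0)
    ≡⟨ cong₂ _+_ (sumAll-⊂ S _) (sumAll-0 n) ⟩
  (sum⊆ S (g ∘ (false ∷_)) - g (false ∷ S)) + + 0
    ≡⟨ ℤₚ.+-identityʳ _ ⟩
  sum⊆ (false ∷ S) g - g (false ∷ S) ∎
  where open ≡-Reasoning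
sumAll-⊂ (true  ∷ S) g = begin
  sumAll (λ T → if does (T ⊂? true ∷ S) then g T else + 0)
    ≡⟨ sumAll-∷ (λ T → if does (T ⊂? true ∷ S) then g T else + 0) ⟩
  sumAll (λ T → if does (T ⊆? S) then g (false ∷ T) else + 0)
    + sumAll (λ T → if does (T ⊂? S) then g (true ∷ T) else + 0)
    ≡⟨ cong₂ _+_ (sumAll-⊆ S _) (sumAll-⊂ S _) ⟩
  sum⊆ S (g ∘ (false ∷_)) + (sum⊆ S (g ∘ (true ∷_)) - g (true ∷ S))
    ≡⟨ ℤₚ.+-assoc (sum⊆ S (g ∘ (false ∷_))) (sum⊆ S (g ∘ (true ∷_))) (- g (true ∷ S)) ⟨
  sum⊆ (true ∷ S) g - g (true ∷ S) ∎
  where open ≡-Reasoning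

𝟙InS : ∀ {n} → (Subset n → ℕ) → ℤ → Subset n → ℤ
𝟙InS ρ i T = if does (+ rank ρ ℤ.≤? + ρ T + i) then + 1 else + 0

-- T ∈ 𝒮ᵢ iff excess ρ i T ≥ 0, so 𝟙InS depends on nothing else.
excess : ∀ {n} → (Subset n → ℕ) → ℤ → Subset n → ℤ
excess ρ i T = + ρ T + i - + rank ρ

≤-by-difference : ∀ {a b c d} → b - a ≡ d - c → a ℤ.≤ b → c ℤ.≤ d
≤-by-difference eq a≤b = ℤₚ.0≤i-j⇒j≤i (subst (ℤ.0ℤ ℤ.≤_) eq (ℤₚ.i≤j⇒0≤j-i a≤b))

𝟙InS-∈ : ∀ {n} (ρ : Subset n → ℕ) i T → InS ρ i T → 𝟙InS ρ i T ≡ + 1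
𝟙InS-∈ ρ i T T∈ = cong (if_then + 1 else + 0) (dec-true (+ rank ρ ℤ.≤? + ρ T + i) T∈)

𝟙InS-∉ : ∀ {n} (ρ : Subset n → ℕ) i T → ¬ InS ρ i T → 𝟙InS ρ i T ≡ + 0
𝟙InS-∉ ρ i T T∉ = cong (if_then + 1 else + 0) (dec-false (+ rank ρ ℤ.≤? + ρ T + i) T∉)

𝟙InS-cong : ∀ {n m} (ρ : Subset n → ℕ) i T (ρ′ : Subset m → ℕ) j T′ →
  excess ρ i T ≡ excess ρ′ j T′ → 𝟙InS ρ i T ≡ 𝟙InS ρ′ j T′
𝟙InS-cong ρ i T ρ′ j T′ eq with + rank ρ ℤ.≤? + ρ T + i | + rank ρ′ ℤ.≤? + ρ′ T′ + j
... | yes _  | yes _   = refl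
... | no  _  | no  _   = refl
... | yes T∈ | no T′∉  = contradiction (≤-by-difference eq T∈) T′∉
... | no T∉  | yes T′∈ = contradiction (≤-by-difference (sym eq) T′∈) T∉

module _ {n} {ρ : Subset n → ℕ} (mono : ρ Preserves _⊆_ ⟶ _≤_) (i : ℤ) where

  InS-upward : ∀ {T S} → T ⊆ S → InS ρ i T → InS ρ i S
  InS-upward T⊆S T∈ = ℤₚ.≤-trans T∈ (ℤₚ.+-monoˡ-≤ i (ℤ.+≤+ (mono T⊆S)))

  μ-fuel-closedForm : ∀ k S → ∣ S ∣ < k → μ-fuel k ρ i S ≡ - altSum⊆ S (𝟙InS ρ i)
  μ-fuel-closedForm (suc k) S |S|<k with + rank ρ ℤ.≤? + ρ S + i
  ... | no S∉ =
    sym (cong -_ (altSum⊆-vanishes S (𝟙InS ρ i) (λ T⊆S → 𝟙InS-∉ ρ i _ (S∉ ∘ InS-upward T⊆S))))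
  ... | yes S∈ = begin
    - (+ 1 + sumℤ (map (μ-fuel k ρ i) (filter (_⊂? S) (allSubsets n))))
      ≡⟨ cong (λ s → - (+ 1 + s)) (sumℤ-map-filter (_⊂? S) (μ-fuel k ρ i) (allSubsets n)) ⟩
    - (+ 1 + sumAll (λ T → if does (T ⊂? S) then μ-fuel k ρ i T else + 0))
      ≡⟨ cong (λ s → - (+ 1 + s)) (trans (sumAll-cong induction) (sumAll-⊂ S ν)) ⟩
    - (+ 1 + (sum⊆ S ν - ν S))
      ≡⟨ cong (λ s → - (+ 1 + (s - ν S))) sum⊆-ν ⟩
    - (+ 1 + (- + 1 - ν S))
      ≡⟨ cancel (ν S) ⟩
    ν S ∎
    where
    open ≡-Reasoning
    ν : Subset n → ℤ
    ν T = - altSum⊆ T (𝟙InS ρ i)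

    induction : (λ T → if does (T ⊂? S) then μ-fuel k ρ i T else + 0)
              ≗ (λ T → if does (T ⊂? S) then ν T else + 0)
    induction T with T ⊂? S
    ... | yes T⊂S = μ-fuel-closedForm k T (ℕₚ.<-≤-trans (p⊂q⇒∣p∣<∣q∣ T⊂S) (ℕₚ.≤-pred |S|<k))
    ... | no  _   = refl

    sum⊆-ν : sum⊆ S ν ≡ - + 1
    sum⊆-ν = trans (sum⊆-neg S (λ T → altSum⊆ T (𝟙InS ρ i)))
                   (cong -_ (trans (sum⊆-altSum⊆ S (𝟙InS ρ i)) (𝟙InS-∈ ρ i S S∈)))

    cancel : ∀ v → - (+ 1 + (- + 1 - v)) ≡ v
    cancel = solve-∀

  μ-closedForm : ∀ S → μ ρ i S ≡ - altSum⊆ S (𝟙InS ρ i)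
  μ-closedForm S = μ-fuel-closedForm (suc n) S (ℕ.s≤s (∣p∣≤n S))

module _ {n} {ρ : Subset (suc n) → ℕ} (mono : ρ Preserves _⊆_ ⟶ _≤_) (i : ℤ)
         {e : Fin (suc n)} {S : Subset (suc n)} (e∈S : e ∈ S) where

  private
    altSum⊆-with altSum⊆-without : ℤ
    altSum⊆-with    = altSum⊆ (S ∖ e) (λ T → 𝟙InS ρ i (insertAt T e true))
    altSum⊆-without = altSum⊆ (S ∖ e) (λ T → 𝟙InS ρ i (insertAt T e false))

  μ-split : μ ρ i S ≡ - (altSum⊆-with - altSum⊆-without)
  μ-split = trans (μ-closedForm mono i S) (cong -_ (altSum⊆-split S e (𝟙InS ρ i) e∈S))

  μ-vanishes : (∀ T → 𝟙InS ρ i (insertAt T e true) ≡ 𝟙InS ρ i (insertAt T e false)) →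
    μ ρ i S ≡ + 0
  μ-vanishes with≗without = trans μ-split (cong -_ (begin
    altSum⊆-with - altSum⊆-without     ≡⟨ cong (_- altSum⊆-without) (altSum⊆-cong (S ∖ e) with≗without) ⟩
    altSum⊆-without - altSum⊆-without  ≡⟨ ℤₚ.+-inverseʳ altSum⊆-without ⟩
    + 0                                ∎))
    where open ≡-Reasoning

  μ-deletion-contraction : ∀ {ρ∖ ρ/ : Subset n → ℕ} →
    ρ∖ Preserves _⊆_ ⟶ _≤_ → ρ/ Preserves _⊆_ ⟶ _≤_ → ∀ j k →
    (∀ T → 𝟙InS ρ i (insertAt T e false) ≡ 𝟙InS ρ∖ j T) →
    (∀ T → 𝟙InS ρ i (insertAt T e true) ≡ 𝟙InS ρ/ k T) →
    μ ρ i S ≡ - μ ρ∖ j (S ∖ e) + μ ρ/ k (S ∖ e)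
  μ-deletion-contraction {ρ∖} {ρ/} mono∖ mono/ j k without≗∖ with≗/ = begin
    μ ρ i S
      ≡⟨ μ-split ⟩
    - (altSum⊆-with - altSum⊆-without)
      ≡⟨ cong -_ (cong₂ _-_ (altSum⊆-cong R with≗/) (altSum⊆-cong R without≗∖)) ⟩
    - (altSum⊆ R (𝟙InS ρ/ k) - altSum⊆ R (𝟙InS ρ∖ j))
      ≡⟨ rearrange (altSum⊆ R (𝟙InS ρ/ k)) (altSum⊆ R (𝟙InS ρ∖ j)) ⟩
    - (- altSum⊆ R (𝟙InS ρ∖ j)) + - altSum⊆ R (𝟙InS ρ/ k)
      ≡⟨ cong₂ (λ a b → - a + b) (μ-closedForm mono∖ j R) (μ-closedForm mono/ k R) ⟨
    - μ ρ∖ j R + μ ρ/ k R ∎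
    where
    open ≡-Reasoning
    R = S ∖ e
    rearrange : ∀ a b → - (a - b) ≡ - (- b) + - a
    rearrange = solve-∀

insertAt-mono : ∀ {n} {X Y : Subset n} (e : Fin (suc n)) b → X ⊆ Y → insertAt X e b ⊆ insertAt Y e b
insertAt-mono zero b X⊆Y = s⊆s X⊆Y
insertAt-mono {X = _ ∷ _} {_ ∷ _} (suc e) b X⊆Y here with X⊆Y here
... | here = here
insertAt-mono {X = _ ∷ _} {_ ∷ _} (suc e) b X⊆Y (there x∈) =
  there (insertAt-mono e b (drop-∷-⊆ X⊆Y) x∈)

insertAt-true≡∪⁅⁆ : ∀ {n} (X : Subset n) e → insertAt X e true ≡ insertAt X e false ∪ ⁅ e ⁆
insertAt-true≡∪⁅⁆ X       zero    = cong (true ∷_) (sym (∪-identityʳ X))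
insertAt-true≡∪⁅⁆ (x ∷ X) (suc e) = cong₂ _∷_ (sym (∨-identityʳ x)) (insertAt-true≡∪⁅⁆ X e)

⁅⁆⊆insertAt-true : ∀ {n} (X : Subset n) e → ⁅ e ⁆ ⊆ insertAt X e true
⁅⁆⊆insertAt-true X e = subst (⁅ e ⁆ ⊆_) (sym (insertAt-true≡∪⁅⁆ X e)) (q⊆p∪q _ ⁅ e ⁆)

insertAt-⊤ : ∀ n (e : Fin (suc n)) → insertAt ⊤ e true ≡ ⊤
insertAt-⊤ n       zero    = refl
insertAt-⊤ (suc n) (suc e) = cong (true ∷_) (insertAt-⊤ n e)

⊤-remove : ∀ n (e : Fin (suc n)) → ⊤ remove e ≡ insertAt ⊤ e false
⊤-remove n       zero    = cong (false ∷_) (p─⊥≡p ⊤)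
⊤-remove (suc n) (suc e) = cong (true ∷_) (⊤-remove n e)

+[m∸n]≡+m-+n : ∀ {m n} → n ≤ m → + (m ∸ n) ≡ + m - + n
+[m∸n]≡+m-+n {m} {n} n≤m = trans (sym (ℤₚ.⊖-≥ n≤m)) (sym (ℤₚ.m-n≡m⊖n m n))

module _ {n} (M : Matroid n) where

  ρ-monotone : ρ M Preserves _⊆_ ⟶ _≤_
  ρ-monotone {X} {Y} = ρ-mono M X Y

  ρ-subadditive : ∀ X Y → ρ M (X ∪ Y) ≤ ρ M X ℕ.+ ρ M Y
  ρ-subadditive X Y = ℕₚ.≤-trans (ℕₚ.m≤m+n _ _) (ρ-submod M X Y)

  ρ-⁅⁆≤1 : ∀ e → ρ M ⁅ e ⁆ ≤ 1
  ρ-⁅⁆≤1 e = subst (ρ M ⁅ e ⁆ ≤_) (∣⁅x⁆∣≡1 e) (ρ-bounded M ⁅ e ⁆)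

  ρ-∪-loop : ∀ {e} → IsLoop M e → ∀ X → ρ M (X ∪ ⁅ e ⁆) ≡ ρ M X
  ρ-∪-loop {e} loop X = ℕₚ.≤-antisym
    (ℕₚ.≤-trans (ρ-subadditive X ⁅ e ⁆)
                (ℕₚ.≤-reflexive (trans (cong (ρ M X ℕ.+_) loop) (ℕₚ.+-identityʳ _))))
    (ρ-monotone (p⊆p∪q ⁅ e ⁆))

module _ {n} (M : Matroid (suc n)) (e : Fin (suc n)) where

  del-mono : del M e Preserves _⊆_ ⟶ _≤_
  del-mono = ρ-monotone M ∘ insertAt-mono e false

  con-mono : con M e Preserves _⊆_ ⟶ _≤_
  con-mono = ℕₚ.∸-monoˡ-≤ (ρ M ⁅ e ⁆) ∘ ρ-monotone M ∘ insertAt-mono e true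

  rank-del-link : ¬ IsColoop M e → rank (del M e) ≡ rank (ρ M)
  rank-del-link ¬coloop = ℕₚ.≤-antisym (ρ-monotone M ⊆⊤)
    (ℕₚ.≮⇒≥ (¬coloop ∘ subst (λ X → ρ M X < rank (ρ M)) (sym (⊤-remove n e))))

  rank-del-coloop : IsColoop M e → suc (rank (del M e)) ≡ rank (ρ M)
  rank-del-coloop coloop =
    ℕₚ.≤-antisym (subst (λ X → ρ M X < rank (ρ M)) (⊤-remove n e) coloop) d≤1+r
    where
    open ℕₚ.≤-Reasoning
    E∖e = insertAt ⊤ e false
    d≤1+r : rank (ρ M) ≤ suc (ρ M E∖e)
    d≤1+r = begin
      ρ M ⊤                  ≡⟨ cong (ρ M) (trans (sym (insertAt-⊤ n e)) (insertAt-true≡∪⁅⁆ ⊤ e)) ⟩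
      ρ M (E∖e ∪ ⁅ e ⁆)       ≤⟨ ρ-subadditive M E∖e ⁅ e ⁆ ⟩
      ρ M E∖e ℕ.+ ρ M ⁅ e ⁆  ≤⟨ ℕₚ.+-monoʳ-≤ (ρ M E∖e) (ρ-⁅⁆≤1 M e) ⟩
      ρ M E∖e ℕ.+ 1          ≡⟨ ℕₚ.+-comm (ρ M E∖e) 1 ⟩
      suc (ρ M E∖e)          ∎

  𝟙InS-loop : IsLoop M e → ∀ i T →
    𝟙InS (ρ M) i (insertAt T e true) ≡ 𝟙InS (ρ M) i (insertAt T e false)
  𝟙InS-loop loop i T = 𝟙InS-cong (ρ M) i (insertAt T e true) (ρ M) i (insertAt T e false)
    (cong (λ r → + r + i - + rank (ρ M))
          (trans (cong (ρ M) (insertAt-true≡∪⁅⁆ T e)) (ρ-∪-loop M loop (insertAt T e false))))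

  𝟙InS-con : ∀ i T → 𝟙InS (ρ M) i (insertAt T e true) ≡ 𝟙InS (con M e) i T
  𝟙InS-con i T = 𝟙InS-cong (ρ M) i (insertAt T e true) (con M e) i T (begin
    + y + i - + d
      ≡⟨ cancel (+ y) i (+ d) (+ a) ⟩
    (+ y - + a) + i - (+ d - + a)
      ≡⟨ cong₂ (λ u v → u + i - v) (+[m∸n]≡+m-+n a≤y) (+[m∸n]≡+m-+n a≤d) ⟨
    + (y ∸ a) + i - + (d ∸ a)
      ≡⟨ cong (λ X → + (y ∸ a) + i - + (ρ M X ∸ a)) (insertAt-⊤ n e) ⟨
    excess (con M e) i T ∎)
    where
    open ≡-Reasoning
    a = ρ M ⁅ e ⁆
    d = rank (ρ M)
    y = ρ M (insertAt T e true)
    a≤y : a ≤ y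
    a≤y = ρ-monotone M (⁅⁆⊆insertAt-true T e)
    a≤d : a ≤ d
    a≤d = ρ-monotone M ⊆⊤
    cancel : ∀ y i d a → y + i - d ≡ (y - a) + i - (d - a)
    cancel = solve-∀

  𝟙InS-del-link : ¬ IsColoop M e → ∀ i T →
    𝟙InS (ρ M) i (insertAt T e false) ≡ 𝟙InS (del M e) i T
  𝟙InS-del-link ¬coloop i T = 𝟙InS-cong (ρ M) i (insertAt T e false) (del M e) i T
    (cong (λ d → + ρ M (insertAt T e false) + i - + d) (sym (rank-del-link ¬coloop)))

  𝟙InS-del-coloop : IsColoop M e → ∀ i T →
    𝟙InS (ρ M) i (insertAt T e false) ≡ 𝟙InS (del M e) (i - + 1) T
  𝟙InS-del-coloop coloop i T = 𝟙InS-cong (ρ M) i (insertAt T e false) (del M e) (i - + 1) T (begin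
    + x + i - + rank (ρ M)  ≡⟨ cong (λ d → + x + i - + d) (rank-del-coloop coloop) ⟨
    + x + i - (+ 1 + + r)    ≡⟨ shift (+ x) i (+ r) ⟩
    + x + (i - + 1) - + r    ∎)
    where
    open ≡-Reasoning
    x = ρ M (insertAt T e false)
    r = rank (del M e)
    shift : ∀ x i r → x + i - (+ 1 + r) ≡ x + (i - + 1) - r
    shift = solve-∀

lemma2p2 : ∀ {n} (M : Matroid (suc n)) (e : Fin (suc n)) →
    1 ≤ ρ M ⊤ →
    ∀ (i : ℕ) → suc i ≤ ρ M ⊤ →
    ∀ (S : Subset (suc n)) → InS (ρ M) (+ i) S → e ∈ S →
      (IsLoop M e → μ (ρ M) (+ i) S ≡ + 0)
      × (IsColoop M e →
          μ (ρ M) (+ i) S ≡ - μ (del M e) (+ i - + 1) (S ∖ e) + μ (con M e) (+ i) (S ∖ e))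
      × (IsLink M e →
          μ (ρ M) (+ i) S ≡ - μ (del M e) (+ i) (S ∖ e) + μ (con M e) (+ i) (S ∖ e))
lemma2p2 M e _ i _ S _ e∈S =
    (λ loop → μ-vanishes (ρ-monotone M) (+ i) e∈S (𝟙InS-loop M e loop (+ i)))
  , (λ coloop → deletion-contraction (+ i - + 1) (𝟙InS-del-coloop M e coloop (+ i)))
  , (λ (_ , ¬coloop) → deletion-contraction (+ i) (𝟙InS-del-link M e ¬coloop (+ i)))
  where
  deletion-contraction : ∀ j →
    (∀ T → 𝟙InS (ρ M) (+ i) (insertAt T e false) ≡ 𝟙InS (del M e) j T) →
    μ (ρ M) (+ i) S ≡ - μ (del M e) j (S ∖ e) + μ (con M e) (+ i) (S ∖ e)
  deletion-contraction j without≗∖ = μ-deletion-contraction (ρ-monotone M) (+ i) e∈S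
    (del-mono M e) (con-mono M e) j (+ i) without≗∖ (𝟙InS-con M e (+ i))
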